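{- Let $n\ge 1$. For formulas $D_1,\dots,D_n,C$ define $U_1:=\Diamond\neg(D_1\rhd\neg C)$ and $U_{k+1}:=\Diamond\big((D_k\rhd D_{k+1})\wedge U_k\big)$, and let $\mathsf R^n$ be the scheme $$A\rhd B\to \big(U_n\wedge(D_n\rhd A)\big)\rhd (B\wedge\Box C)$$ (all instances with arbitrary formulas $A,B,C,D_1,\dots,D_n$). Let $(\mathsf R^n)_{gen}$ be the following condition on a generalised Veltman frame $\langle W,R,\{S_w\}\rangle$: for all worlds $w,x_1,\dots,x_n,y,z$ and all sets $\mathbb A,\mathbb B,\mathbb C,\mathbb D_1,\dots,\mathbb D_n\subseteq W$, if (i) $wRx_nRx_{n-1}R\cdots Rx_1RyRz$; (ii) for all $u$, if $wRu$ and $u\in\mathbb A$ then there is $V$ with $uS_wV$ and $V\subseteq\mathbb B$; (iii) for all $u$, if $x_nRu$ and $u\in\mathbb D_n$ then there is $V$ with $uS_{x_n}V$ and $V\subseteq\mathbb A$; (iv) for each $i\in\{1,\dots,n-1\}$ and all $u$, if $x_iRu$ and $u\in\mathbb D_i$ then there is $V$ with $uS_{x_i}V$ and $V\subseteq\mathbb D_{i+1}$; (v) for all $V$, if $zS_yV$ then $V\cap\mathbb C\neq\emptyset$; (vi) $z\in\mathbb D_1$; then there is $V\subseteq\mathbb B$ with $x_nS_wV$ and $\{t:\exists v\in V\ vRt\}\subseteq\mathbb C$. Then for every generalised Veltman frame $\mathfrak F$: $\mathfrak F$ satisfies $(\mathsf R^n)_{gen}$ if and only if every instance of $\mathsf R^n$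 is forced at every world of every generalised Veltman model based on $\mathfrak F$.
   Context: Formulas are built from propositional variables and $\bot$ using $\to$ (other Boolean connectives defined as usual), $\Box$ and binary $\rhd$; $\Diamond A:=\neg\Box\neg A$. A generalised Veltman frame is $\langle W,R,\{S_w:w\in W\}\rangle$ with $W\neq\emptyset$, $R$ transitive and conversely well-founded, and for each $w$, with $R[w]=\{v:wRv\}$: $S_w\subseteq R[w]\times(\mathcal P(R[w])\setminus\{\emptyset\})$; $wRu$ implies $uS_w\{u\}$; if $uS_wV$ and $vS_wZ_v$ for all $v\in V$ then $uS_w\bigcup_{v\in V}Z_v$; $wRuRv$ implies $uS_w\{v\}$; if $uS_wV$ and $V\subseteq Z\subseteq R[w]$ then $uS_wZ$. A model on the frame adds a valuation of propositional variables as subsets of $W$. Forcing is classical for Boolean connectives, $w\Vdash\Box A$ iff all $R$-successors of $w$ force $A$, and $w\Vdash A\rhd B$ iff for every $u$ with $wRu$ and $u\Vdash A$ there is $V$ with $uS_wV$ and every element of $V$ forcing $B$. -}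

module Defs where

open import Data.Nat using (ℕ; zero; suc; _≤_; _<_)
open import Data.Bool using (Bool; true)
open import Data.Product using (Σ; ∃; _×_; _,_)
open import Data.Empty using (⊥)
open import Relation.Binary.PropositionalEquality using (_≡_)
open import Induction.WellFounded using (WellFounded)
open import Function.Bundles using (_⇔_)

infixr 5 _⇒_
infix 6 _▷_

data Fm : Set where
  var : ℕ → Fm
  ⊥' : Fm
  _⇒_ : Fm → Fm → Fm
  □ : Fm → Fm
  _▷_ : Fm → Fm → Fm

¬' : Fm → Fm
¬' A = A ⇒ ⊥'

_∧'_ : Fm → Fm → Fm
A ∧' B = ¬' (A ⇒ ¬' B)

◇ : Fm → Fm
◇ A = ¬' (□ (¬' A))

-- Subsets of a set (classical power set, as characteristic functions)

Subset : Set → Set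
Subset W = W → Bool

_∈_ : {W : Set} → W → Subset W → Set
w ∈ X = X w ≡ true

_⊆_ : {W : Set} → Subset W → Subset W → Set
X ⊆ Y = ∀ w → w ∈ X → w ∈ Y

record GVFrame : Set₁ where
  field
    W : Set
    R : W → W → Set
    S : W → W → Subset W → Set          -- S w u V  means  u S_w V
    inhabited : W
    R-trans : ∀ {x y z} → R x y → R y z → R x z
    R-cwf : WellFounded (λ x y → R y x)
    S-dom : ∀ {w u V} → S w u V → R w u
    S-cod : ∀ {w u V} → S w u V → ∀ v → v ∈ V → R w v
    S-ne  : ∀ {w u V} → S w u V → ∃ λ v → v ∈ V
    S-refl : ∀ {w u} → R w u →
             ∀ (V : Subset W) → (∀ v → (v ∈ V → v ≡ u) × (v ≡ u → v ∈ V)) → S w u V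
    S-trans : ∀ {w u V} → S w u V → (Z : W → Subset W) → (∀ v → v ∈ V → S w v (Z v)) →
              ∀ (U : Subset W) →
              (∀ t → (t ∈ U → ∃ λ v → v ∈ V × t ∈ Z v) × ((∃ λ v → v ∈ V × t ∈ Z v) → t ∈ U)) →
              S w u U
    S-R : ∀ {w u v} → R w u → R u v →
          ∀ (V : Subset W) → (∀ t → (t ∈ V → t ≡ v) × (t ≡ v → t ∈ V)) → S w u V
    S-mono : ∀ {w u V Z} → S w u V → V ⊆ Z → (∀ t → t ∈ Z → R w t) → S w u Z

module _ (F : GVFrame) where
  open GVFrame F

  Valuation : Set
  Valuation = ℕ → Subset W

  _,_⊩_ : Valuation → W → Fm → Set
  val , w ⊩ var p = w ∈ val p
  val , w ⊩ ⊥' = ⊥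
  val , w ⊩ (A ⇒ B) = val , w ⊩ A → val , w ⊩ B
  val , w ⊩ □ A = ∀ v → R w v → val , v ⊩ A
  val , w ⊩ (A ▷ B) = ∀ u → R w u → val , u ⊩ A →
                       ∃ λ (V : Subset W) → S w u V × (∀ v → v ∈ V → val , v ⊩ B)

-- The scheme R^n  (D i stands for D_i, 1 ≤ i ≤ n; other indices unused)

-- U D C k  is  U_k  (for k ≥ 1; U D C 0 is an unused dummy)
U : (ℕ → Fm) → Fm → ℕ → Fm
U D C zero = ⊥'
U D C (suc zero) = ◇ (¬' (D 1 ▷ ¬' C))
U D C (suc (suc k)) = ◇ ((D (suc k) ▷ D (suc (suc k))) ∧' U D C (suc k))

Rn : ℕ → (A B C : Fm) → (D : ℕ → Fm) → Fm
Rn n A B C D = (A ▷ B) ⇒ ((U D C n ∧' (D n ▷ A)) ▷ (B ∧' □ C))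

ValidRn : GVFrame → ℕ → Set
ValidRn F n = ∀ (val : Valuation F) (w : GVFrame.W F) (A B C : Fm) (D : ℕ → Fm) →
              _,_⊩_ F val w (Rn n A B C D)

RnGen : GVFrame → ℕ → Set
RnGen F n =
  ∀ (w : W) (x : ℕ → W) (y z : W) (𝔸 𝔹 ℂ : Subset W) (𝔻 : ℕ → Subset W) →
  R w (x n) → (∀ i → 1 ≤ i → i < n → R (x (suc i)) (x i)) → R (x 1) y → R y z →
  (∀ u → R w u → u ∈ 𝔸 → ∃ λ V → S w u V × V ⊆ 𝔹) →
  (∀ u → R (x n) u → u ∈ 𝔻 n → ∃ λ V → S (x n) u V × V ⊆ 𝔸) →
  (∀ i → 1 ≤ i → i < n → ∀ u → R (x i) u → u ∈ 𝔻 i →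
     ∃ λ V → S (x i) u V × V ⊆ 𝔻 (suc i)) →
  (∀ V → S y z V → ∃ λ v → v ∈ V × v ∈ ℂ) →
  z ∈ 𝔻 1 →
  ∃ λ V → V ⊆ 𝔹 × S w (x n) V × (∀ v t → v ∈ V → R v t → t ∈ ℂ)
  where open GVFrame F

-- Both directions rest on one observation: for sets 𝔸, 𝔹 the clause
-- "every R-successor of x in 𝔸 is S_x-related to a subset of 𝔹" is exactly
-- the forcing clause of A ▷ B at x once 𝔸, 𝔹 are the truth sets of A, B.
--
-- (gen ⇒ valid) Classically (excluded middle) every formula has a truth
--     set, and a world forcing U_k unfolds into a descending chain
--     x_k R x_{k-1} R ⋯ R x_1 R y R z carrying the links D_i ▷ D_{i+1}
--     (a `Chain`, built by induction on k).  Feeding the truth sets and the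
--     chain of U_n into (R^n)_gen yields the set V witnessing B ∧ □C.
-- (valid ⇒ gen) Given the data of (R^n)_gen, read 𝔸, 𝔹, ℂ, 𝔻_i as propositional
--     variables.  Then x_k forces U_k for 1 ≤ k ≤ n (induction on k,
--     intuitionistically), so validity of R^n at w applied to x_n gives V,
--     and double negation elimination extracts V ⊆ 𝔹 and R[V] ⊆ ℂ.
module Submission where

open import Defs
open import Data.Nat using (ℕ; zero; suc; _≤_; _<_; z≤n; s≤s; _≟_)
open import Level using (0ℓ)
open import Axiom.ExcludedMiddle using (ExcludedMiddle)
open import Function.Bundles using (_⇔_)

open import Data.Nat.Properties using (<⇒≤; ≤-refl; <⇒≢; n<1+n; m<n⇒m<1+n; m<1+n⇒m<n∨m≡n)
open import Data.Product using (∃; _×_; _,_; proj₁; proj₂)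
open import Data.Sum using (inj₁; inj₂)
open import Data.Empty using (⊥-elim)
open import Relation.Nullary using (¬_; yes; no; does)
open import Relation.Binary.PropositionalEquality using (_≡_; refl; sym; subst; subst₂)
open import Axiom.DoubleNegationElimination using (em⇒dne)
open import Function.Bundles using (mk⇔)

Below : ℕ → (ℕ → Set) → Set
Below k P = ∀ i → 1 ≤ i → i < k → P i

below-suc : ∀ {k} {P : ℕ → Set} → Below k P → P k → Below (suc k) P
below-suc old top i 1≤i i<1+k with m<1+n⇒m<n∨m≡n i<1+k
... | inj₁ i<k  = old i 1≤i i<k
... | inj₂ refl = top

update : {A : Set} → (ℕ → A) → ℕ → A → ℕ → A
update x k a i with i ≟ k
... | yes _ = a
... | no _  = x i

update-at : {A : Set} (x : ℕ → A) (k : ℕ) (a : A) → update x k a k ≡ a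
update-at x k a with k ≟ k
... | yes _  = refl
... | no k≢k = ⊥-elim (k≢k refl)

update-below : {A : Set} (x : ℕ → A) {k : ℕ} (a : A) {i : ℕ} → i < k → update x k a i ≡ x i
update-below x {k} a {i} i<k with i ≟ k
... | yes i≡k = ⊥-elim (<⇒≢ i<k i≡k)
... | no _    = refl

module _ (F : GVFrame) where
  open GVFrame F

  -- 𝕏 ▷ 𝕐 holds at x when read on sets: the common shape of (ii)–(iv).
  SetInterprets : W → Subset W → Subset W → Set
  SetInterprets x 𝕏 𝕐 = ∀ u → R x u → u ∈ 𝕏 → ∃ λ V → S x u V × V ⊆ 𝕐

  module Forcing (em : ExcludedMiddle 0ℓ) (val : Valuation F) where

    _⊩_ : W → Fm → Set
    w ⊩ A = _,_⊩_ F val w A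

    dne : {P : Set} → ¬ ¬ P → P
    dne = em⇒dne em

    ⟦_⟧ : Fm → Subset W
    ⟦ A ⟧ t = does (em {t ⊩ A})

    ⊩⇒∈ : ∀ A t → t ⊩ A → t ∈ ⟦ A ⟧
    ⊩⇒∈ A t t⊩A with em {t ⊩ A}
    ... | yes _ = refl
    ... | no t⊮A = ⊥-elim (t⊮A t⊩A)

    ∈⇒⊩ : ∀ A t → t ∈ ⟦ A ⟧ → t ⊩ A
    ∈⇒⊩ A t t∈A with em {t ⊩ A}
    ∈⇒⊩ A t refl | yes t⊩A = t⊩A

    ▷⇒SetInterprets : ∀ {x} A B → x ⊩ (A ▷ B) → SetInterprets x ⟦ A ⟧ ⟦ B ⟧
    ▷⇒SetInterprets A B x⊩A▷B u xRu u∈A =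
      let (V , uSV , V⊩B) = x⊩A▷B u xRu (∈⇒⊩ A u u∈A)
      in V , uSV , λ v v∈V → ⊩⇒∈ B v (V⊩B v v∈V)

    ◇-elim : ∀ {u} A → u ⊩ ◇ A → ∃ λ v → R u v × v ⊩ A
    ◇-elim A u⊩◇A = dne λ none → u⊩◇A (λ v uRv v⊩A → none (v , uRv , v⊩A))

    ∧-elim : ∀ {u} A B → u ⊩ (A ∧' B) → (u ⊩ A) × (u ⊩ B)
    ∧-elim A B u⊩A∧B = dne (λ u⊮A → u⊩A∧B (λ a _ → u⊮A a))
                     , dne (λ u⊮B → u⊩A∧B (λ _ b → u⊮B b))

    ¬▷¬-elim : ∀ {y} A C → y ⊩ ¬' (A ▷ ¬' C) →
      ∃ λ z → R y z × z ⊩ A × (∀ V → S y z V → ∃ λ v → v ∈ V × v ⊩ C)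
    ¬▷¬-elim A C y⊮A▷¬C = dne λ none → y⊮A▷¬C λ z yRz z⊩A → dne λ noV →
      none (z , yRz , z⊩A , λ V yzV → dne λ disjoint →
        noV (V , yzV , λ v v∈V v⊩C → disjoint (v , v∈V , v⊩C)))

    -- The configuration encoded by u ⊩ U_k: hypotheses (i), (iv)–(vi) of
    -- (R^n)_gen, with the links D_i ▷ D_{i+1} still given by forcing.
    record Chain (D : ℕ → Fm) (C : Fm) (k : ℕ) (u : W) : Set where
      field
        x          : ℕ → W
        top        : x k ≡ u
        descending : Below k (λ i → R (x (suc i)) (x i))
        y z        : W
        x₁Ry       : R (x 1) y
        yRz        : R y z
        links      : Below k (λ i → x i ⊩ (D i ▷ D (suc i)))
        z-meets-C  : ∀ V → S y z V → ∃ λ v → v ∈ V × v ⊩ C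
        z⊩D₁       : z ⊩ D 1

    extend : ∀ {D C k u x'} → R u x' → x' ⊩ (D (suc k) ▷ D (suc (suc k))) →
             Chain D C (suc k) x' → Chain D C (suc (suc k)) u
    extend {D} {C} {k} {u} {x'} uRx' link c = record
      { x          = x⁺
      ; top        = update-at x K u
      ; descending = below-suc old-steps new-step
      ; y          = y
      ; z          = z
      ; x₁Ry       = subst (λ t → R t y) (sym (keep {1} (s≤s (s≤s z≤n)))) x₁Ry
      ; yRz        = yRz
      ; links      = below-suc old-links new-link
      ; z-meets-C  = z-meets-C
      ; z⊩D₁       = z⊩D₁
      }
      where
      open Chain c
      K : ℕ
      K = suc (suc k)
      x⁺ : ℕ → W
      x⁺ = update x K u
      keep : ∀ {i} → i < K → x⁺ i ≡ x i
      keep = update-below x u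
      old-steps : Below (suc k) (λ i → R (x⁺ (suc i)) (x⁺ i))
      old-steps i 1≤i i<1+k =
        subst₂ R (sym (keep (s≤s i<1+k))) (sym (keep (m<n⇒m<1+n i<1+k))) (descending i 1≤i i<1+k)
      x⁺-old-top : x⁺ (suc k) ≡ x'
      x⁺-old-top = subst (x⁺ (suc k) ≡_) top (keep (n<1+n (suc k)))
      new-step : R (x⁺ K) (x⁺ (suc k))
      new-step = subst₂ R (sym (update-at x K u)) (sym x⁺-old-top) uRx'
      old-links : Below (suc k) (λ i → x⁺ i ⊩ (D i ▷ D (suc i)))
      old-links i 1≤i i<1+k =
        subst (_⊩ (D i ▷ D (suc i))) (sym (keep (m<n⇒m<1+n i<1+k))) (links i 1≤i i<1+k)
      new-link : x⁺ (suc k) ⊩ (D (suc k) ▷ D K)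
      new-link = subst (_⊩ (D (suc k) ▷ D K)) (sym x⁺-old-top) link

    chain : ∀ D C k → 1 ≤ k → ∀ u → u ⊩ U D C k → Chain D C k u
    chain D C (suc zero) _ u u⊩U₁ with ◇-elim (¬' (D 1 ▷ ¬' C)) u⊩U₁
    ... | y , uRy , y⊮D₁▷¬C with ¬▷¬-elim (D 1) C y⊮D₁▷¬C
    ... | z , yRz , z⊩D₁ , z-meets-C = record
      { x = λ _ → u ; top = refl ; descending = λ { _ (s≤s z≤n) (s≤s ()) }
      ; y = y ; z = z ; x₁Ry = uRy ; yRz = yRz ; links = λ { _ (s≤s z≤n) (s≤s ()) }
      ; z-meets-C = z-meets-C ; z⊩D₁ = z⊩D₁ }
    chain D C (suc (suc k)) _ u u⊩U =
      let (x' , uRx' , x'⊩) = ◇-elim ((D (suc k) ▷ D (suc (suc k))) ∧' U D C (suc k)) u⊩U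
          (link , x'⊩U) = ∧-elim (D (suc k) ▷ D (suc (suc k))) (U D C (suc k)) x'⊩
      in extend uRx' link (chain D C (suc k) (s≤s z≤n) x' x'⊩U)

  frameCondition⇒valid : ExcludedMiddle 0ℓ → ∀ n → 1 ≤ n → RnGen F n → ValidRn F n
  frameCondition⇒valid em n 1≤n gen val w A B C D w⊩A▷B u wRu u⊩Uₙ∧Dₙ▷A =
    let (V , V⊆B , xₙSV , R[V]⊆C) = outcome
    in V , subst (λ t → S w t V) top xₙSV ,
       λ v v∈V → conclude v (V⊆B v v∈V) (λ t → R[V]⊆C v t v∈V)
    where
    open Forcing em val
    hyps : (u ⊩ U D C n) × (u ⊩ (D n ▷ A))
    hyps = ∧-elim (U D C n) (D n ▷ A) u⊩Uₙ∧Dₙ▷A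
    open Chain (chain D C n 1≤n u (proj₁ hyps))
    xₙ⊩Dₙ▷A : x n ⊩ (D n ▷ A)
    xₙ⊩Dₙ▷A = subst (_⊩ (D n ▷ A)) (sym top) (proj₂ hyps)
    outcome : ∃ λ V → V ⊆ ⟦ B ⟧ × S w (x n) V × (∀ v t → v ∈ V → R v t → t ∈ ⟦ C ⟧)
    outcome = gen w x y z ⟦ A ⟧ ⟦ B ⟧ ⟦ C ⟧ (λ i → ⟦ D i ⟧)
      (subst (R w) (sym top) wRu) descending x₁Ry yRz
      (▷⇒SetInterprets A B w⊩A▷B)
      (▷⇒SetInterprets (D n) A xₙ⊩Dₙ▷A)
      (λ i 1≤i i<n → ▷⇒SetInterprets (D i) (D (suc i)) (links i 1≤i i<n))
      (λ V yzV → let (v , v∈V , v⊩C) = z-meets-C V yzV in v , v∈V , ⊩⇒∈ C v v⊩C)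
      (⊩⇒∈ (D 1) z z⊩D₁)
    conclude : ∀ v → v ∈ ⟦ B ⟧ → (∀ t → R v t → t ∈ ⟦ C ⟧) → v ⊩ (B ∧' □ C)
    conclude v v∈B R[v]⊆C refute = refute (∈⇒⊩ B v v∈B) (λ t vRt → ∈⇒⊩ C t (R[v]⊆C t vRt))

  -- Validity of R^n forces (R^n)_gen: test R^n on the valuation of the sets.
  valid⇒frameCondition : ExcludedMiddle 0ℓ → ∀ n → 1 ≤ n → ValidRn F n → RnGen F n
  valid⇒frameCondition em n 1≤n valid w x y z 𝔸 𝔹 ℂ 𝔻
                       wRxₙ descending x₁Ry yRz ii iii iv z-meets-C z∈𝔻₁ =
    let (V , xₙSV , V⊩B∧□C) = instance-at-xₙ
    in V , (λ t t∈V → dne λ t∉𝔹 → V⊩B∧□C t t∈V (λ t∈𝔹 _ → t∉𝔹 t∈𝔹)) , xₙSV ,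
       (λ s t s∈V sRt → dne λ t∉ℂ → V⊩B∧□C s s∈V (λ _ R[s]⊆ℂ → t∉ℂ (R[s]⊆ℂ t sRt)))
    where
    dne : {P : Set} → ¬ ¬ P → P
    dne = em⇒dne em
    val : Valuation F
    val 0 = 𝔸
    val 1 = 𝔹
    val 2 = ℂ
    val (suc (suc (suc i))) = 𝔻 i
    D : ℕ → Fm
    D i = var (suc (suc (suc i)))
    C : Fm
    C = var 2
    xₖ⊩Uₖ : ∀ k → 1 ≤ k → k ≤ n → _,_⊩_ F val (x k) (U D C k)
    xₖ⊩Uₖ (suc zero) _ _ □¬ = □¬ y x₁Ry λ y⊩D₁▷¬C →
      let (V , zSV , V⊩¬C) = y⊩D₁▷¬C z yRz z∈𝔻₁
          (t , t∈V , t∈ℂ) = z-meets-C V zSV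
      in V⊩¬C t t∈V t∈ℂ
    xₖ⊩Uₖ (suc (suc k)) _ k+2≤n □¬ = □¬ (x (suc k)) (descending (suc k) (s≤s z≤n) k+2≤n)
      (λ use → use (iv (suc k) (s≤s z≤n) k+2≤n) (xₖ⊩Uₖ (suc k) (s≤s z≤n) (<⇒≤ k+2≤n)))
    instance-at-xₙ : ∃ λ V → S w (x n) V × (∀ v → v ∈ V → _,_⊩_ F val v (var 1 ∧' □ C))
    instance-at-xₙ = valid val w (var 0) (var 1) C D ii (x n) wRxₙ
                       (λ use → use (xₖ⊩Uₖ n 1≤n ≤-refl) iii)

theorem8p3 : ExcludedMiddle 0ℓ → (n : ℕ) → 1 ≤ n → (F : GVFrame) →
    RnGen F n ⇔ ValidRn F n
theorem8p3 em n 1≤n F = mk⇔ (frameCondition⇒valid F em n 1≤n) (valid⇒frameCondition F em n 1≤n)
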